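{- Let $M$ be a positive integer and let $h, h'$ be positive integers with $h^2\mid M$, $h'^2\mid M$ and $h\mid h'$. Then $\Gamma_0^{*,h}(M)\subset\Gamma_0^{*,h'}(M)$ and $G_0^{*,h}(M)\subset G_0^{*,h'}(M)$.
   Context: $\mathbb{Z}_{(M)} = \{a/b\in\mathbb{Q}: a,b\in\mathbb{Z},\ \gcd(b,M)=1\}$. For a positive integer $h$ with $h^2\mid M$: $\Gamma_0^{*,h}(M) = \left\{\frac{1}{\sqrt e}\begin{pmatrix} ep & q/h\\ Mr/h & es\end{pmatrix}\in\mathrm{SL}_2(\mathbb{R}) : e\in\mathbb{Z}_{>0},\ e\mid M/h^2,\ p,q,r,s\in\mathbb{Z}\right\}$, $G_0^{*,h}(M) = \left\{\frac{1}{\sqrt e}\begin{pmatrix} ep & q/h\\ Mr/h & es\end{pmatrix}\in\mathrm{SL}_2(\mathbb{R}) : e\in\mathbb{Z}_{>0},\ e\mid M/h^2,\ p,q,r,s\in\mathbb{Z}_{(M)}\right\}$. -}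

module Defs where

open import Data.Nat as ℕ using (ℕ; NonZero; _^_)
open import Data.Nat.Divisibility using (_∣_; quotient)
open import Data.Nat.Coprimality using (Coprime)
open import Data.Integer as ℤ using (ℤ; +_)
open import Data.Rational as ℚ using (ℚ; _/_)
open import Data.Product using (Σ; ∃; _×_)
open import Relation.Binary.PropositionalEquality using (_≡_)

record M2 : Set where
  constructor mat
  field
    a b c d : ℚ
open M2 public

det : M2 → ℚ
det (mat a b c d) = (a ℚ.* d) ℚ.- (b ℚ.* c)

smul : ℚ → M2 → M2
smul t (mat a b c d) = mat (t ℚ.* a) (t ℚ.* b) (t ℚ.* c) (t ℚ.* d)

nQ : ℕ → ℚ
nQ n = + n / 1

zQ : ℤ → ℚ
zQ z = z / 1

inv : (h : ℕ) → .{{NonZero h}} → ℚ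
inv h = + 1 / h

-- A pair (e , A) stands for the real matrix (1/√e)·A.
record Rep : Set where
  constructor rep
  field
    e : ℕ
    A : M2
open Rep public

-- Equality of the represented real matrices (1/√e)A = (1/√e')A', for A ≠ 0:
-- this holds iff A' = t·A with t = √(e'/e), which is then a positive rational
-- with t²·e = e'.
SameReal : Rep → Rep → Set
SameReal (rep e A) (rep e' A') =
  Σ ℚ λ t → ℚ.Positive t × ((t ℚ.* t) ℚ.* nQ e ≡ nQ e') × (A' ≡ smul t A)

IsInt : ℚ → Set
IsInt x = Σ ℤ λ z → x ≡ zQ z

-- ℤ_(M): rationals whose (reduced) denominator is coprime to M
InZloc : ℕ → ℚ → Set
InZloc M x = Coprime (ℚ.denominatorℕ x) M

M/h² : (M h : ℕ) → h ^ 2 ∣ M → ℕ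
M/h² M h hh = quotient hh

-- (1/√e)A is of the form (1/√e)[[e p , q/h],[M r/h , e s]] ∈ SL₂(ℝ),
-- e > 0, e ∣ M/h², with p,q,r,s satisfying the coefficient predicate P.
Member : (P : ℚ → Set) (M h : ℕ) → .{{NonZero h}} → h ^ 2 ∣ M → Rep → Set
Member P M h hh (rep e A) =
  NonZero e × (e ∣ M/h² M h hh) ×
  (Σ ℚ λ p → Σ ℚ λ q → Σ ℚ λ r → Σ ℚ λ s →
     P p × P q × P r × P s ×
     (A ≡ mat (nQ e ℚ.* p) (q ℚ.* inv h) ((nQ M ℚ.* r) ℚ.* inv h) (nQ e ℚ.* s)) ×
     (det A ≡ nQ e))

InΓ0 : (M h : ℕ) → .{{NonZero h}} → h ^ 2 ∣ M → Rep → Set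
InΓ0 M h hh = Member IsInt M h hh

InG0 : (M h : ℕ) → .{{NonZero h}} → h ^ 2 ∣ M → Rep → Set
InG0 M h hh = Member (InZloc M) M h hh

{-# OPTIONS --safe #-}
module Submission where

-- Write h′ = k h and M = f e h², where e ∣ M/h² is the scaling exponent of the element.
-- The determinant condition reads e·ps − f·qr = 1 with p, q, r, s ∈ ℤ_(M); a common
-- divisor of e and f divides M and becomes a unit of ℤ_(M), so gcd(e, f) = 1.  Since also
-- f e = N′ k² with N′ = M/h′², putting g = gcd(e, k) gives e = e₂ g², k = k₁ g and e₂ ∣ N′.
-- Dividing the integer matrix by g then rewrites the same real matrix as
-- (1/√e₂)[[e₂·gp, k₁q/h′], [M·k₁r/h′, e₂·gs]], an element of the group at level h′.

open import Defs
open import Data.Nat as ℕ using (ℕ; NonZero; _^_; _*_; suc)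
open import Data.Nat.Divisibility as D using (_∣_; divides; divides-refl)
open import Data.Nat.Coprimality as C using (Coprime)
open import Data.Nat.GCD using (gcd; GCD; gcd-GCD; GCD-*; gcd[m,n]∣m; gcd[m,n]∣n; gcd[m,n]≢0)
import Data.Nat.Properties as ℕP
import Data.Nat.Tactic.RingSolver as NS
open import Data.Integer as ℤ using (+_)
import Data.Integer.Properties as ℤP
open import Data.Rational as ℚ using (ℚ; _/_; 1ℚ)
import Data.Rational.Properties as ℚP
open import Data.Rational.Unnormalised as U using (mkℚᵘ; *≡*)
import Data.Rational.Unnormalised.Properties as UP
open import Data.Rational.Solver using (module +-*-Solver)
open import Data.Product using (Σ; _×_; _,_)
open import Data.Sum using (inj₁)
open import Function using (id)
open import Relation.Binary.PropositionalEquality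
open +-*-Solver using (solve; _:*_; _:-_; _:=_; con)

divisor-coprime : ∀ {d m n} → d ∣ m → Coprime m n → Coprime d n
divisor-coprime d∣m cop (i∣d , i∣n) = cop (D.∣-trans i∣d d∣m , i∣n)

coprime-* : ∀ {m n o} → Coprime m o → Coprime n o → Coprime (m * n) o
coprime-* c₁ c₂ (i∣mn , i∣o) = c₂ (C.coprime-divisor (divisor-coprime i∣o (C.sym c₁)) i∣mn , i∣o)

gcd-cofactors : ∀ m n .{{_ : NonZero m}} →
  Σ ℕ λ g → NonZero g × Σ ℕ λ m₁ → Σ ℕ λ n₁ → m ≡ m₁ * g × n ≡ n₁ * g × Coprime m₁ n₁
gcd-cofactors m n = g , g≢0 , m₁ , n₁ , m≡m₁g , n≡n₁g ,
  C.GCD≡1⇒coprime (GCD-* {{g≢0}} (subst₂ (λ a b → GCD a b (1 * g)) m≡m₁g n≡n₁g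
    (subst (GCD m n) (sym (ℕP.*-identityˡ g)) (gcd-GCD m n))))
  where
  g m₁ n₁ : ℕ
  g = gcd m n
  g≢0 : NonZero g
  g≢0 = ℕ.≢-nonZero (gcd[m,n]≢0 m n (inj₁ (ℕ.≢-nonZero⁻¹ m)))
  m₁ = D.quotient (gcd[m,n]∣m m n)
  n₁ = D.quotient (gcd[m,n]∣n m n)
  m≡m₁g : m ≡ m₁ * g
  m≡m₁g = D.m∣n⇒n≡quotient*m (gcd[m,n]∣m m n)
  n≡n₁g : n ≡ n₁ * g
  n≡n₁g = D.m∣n⇒n≡quotient*m (gcd[m,n]∣n m n)

coprime-∣-cofactor : ∀ {e f k N} .{{_ : NonZero k}} → Coprime k e → f * e ≡ N * (k * k) → e ∣ N
coprime-∣-cofactor {e} {f} {k} {N} cop eq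
  with C.coprime-divisor (coprime-* cop cop) (divides N (trans (ℕP.*-comm e f) eq))
... | divides-refl f₁ = divides f₁ (ℕP.*-cancelʳ-≡ N (f₁ * e) (k * k) {{ℕP.m*n≢0 k k}}
  (trans (sym eq) (reorder f₁ (k * k) e)))
  where
  reorder : ∀ a b c → (a * b) * c ≡ (a * c) * b
  reorder = NS.solve-∀

square-part : ∀ {e f k N} .{{_ : NonZero e}} .{{_ : NonZero k}} → Coprime e f → f * e ≡ N * (k * k) →
  Σ ℕ λ g → NonZero g × Σ ℕ λ e₂ → Σ ℕ λ k₁ → e ≡ e₂ * (g * g) × k ≡ k₁ * g × e₂ ∣ N
square-part {e} {f} {k} {N} cop eq with gcd-cofactors e k
... | g , g≢0 , e₁ , k₁ , refl , refl , cop₁ with g∣e₁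
  where
  instance _ = g≢0
  g∣e₁ : g ∣ e₁
  g∣e₁ = C.coprime-divisor (divisor-coprime (D.n∣m*n e₁) cop)
    (divides (N * (k₁ * k₁)) (ℕP.*-cancelʳ-≡ (f * e₁) _ g
      (trans (ℕP.*-assoc f e₁ g) (trans eq (reorder N k₁ g)))))
    where
    reorder : ∀ N k g → N * ((k * g) * (k * g)) ≡ ((N * (k * k)) * g) * g
    reorder = NS.solve-∀
... | divides-refl e₂ = g , g≢0 , e₂ , k₁ , ℕP.*-assoc e₂ g g , refl ,
  coprime-∣-cofactor {f = f} {{ℕP.m*n≢0⇒m≢0 k₁}} (C.sym (divisor-coprime (D.m∣m*n g) cop₁))
    (ℕP.*-cancelʳ-≡ (f * e₂) (N * (k₁ * k₁)) (g * g) {{ℕP.m*n≢0 g g {{g≢0}} {{g≢0}}}}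
      (trans (reorderˡ f e₂ g) (trans eq (reorderʳ N k₁ g))))
  where
  reorderˡ : ∀ f e g → (f * e) * (g * g) ≡ f * ((e * g) * g)
  reorderˡ = NS.solve-∀
  reorderʳ : ∀ N k g → N * ((k * g) * (k * g)) ≡ (N * (k * k)) * (g * g)
  reorderʳ = NS.solve-∀

cancel-square : ∀ a b k n .{{_ : NonZero n}} → a * n ^ 2 ≡ b * (k * n) ^ 2 → a ≡ b * (k * k)
cancel-square a b k n eq = ℕP.*-cancelʳ-≡ a (b * (k * k)) (n ^ 2) {{ℕP.m^n≢0 n 2}} (trans eq (reorder b k n))
  where
  reorder : ∀ b k n → b * ((k * n) * ((k * n) * 1)) ≡ (b * (k * k)) * (n * (n * 1))
  reorder = NS.solve-∀

toℚᵘ-/ : ∀ i n → ℚ.toℚᵘ (i / suc n) U.≃ mkℚᵘ i n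
toℚᵘ-/ i n = ℚP.toℚᵘ-fromℚᵘ (mkℚᵘ i n)

zQ-* : ∀ i j → zQ (i ℤ.* j) ≡ zQ i ℚ.* zQ j
zQ-* i j = ℚP.toℚᵘ-injective (begin-equality
  ℚ.toℚᵘ (zQ (i ℤ.* j))             ≃⟨ toℚᵘ-/ (i ℤ.* j) 0 ⟩
  mkℚᵘ i 0 U.* mkℚᵘ j 0             ≃⟨ UP.*-cong (UP.≃-sym (toℚᵘ-/ i 0)) (UP.≃-sym (toℚᵘ-/ j 0)) ⟩
  ℚ.toℚᵘ (zQ i) U.* ℚ.toℚᵘ (zQ j)   ≃⟨ ℚP.toℚᵘ-homo-* (zQ i) (zQ j) ⟨
  ℚ.toℚᵘ (zQ i ℚ.* zQ j)            ∎)
  where open UP.≤-Reasoning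

nQ-* : ∀ m n → nQ (m * n) ≡ nQ m ℚ.* nQ n
nQ-* m n = trans (cong zQ (ℤP.pos-* m n)) (zQ-* (+ m) (+ n))

nQ-*-sq : ∀ m n → nQ (m * (n * n)) ≡ nQ m ℚ.* (nQ n ℚ.* nQ n)
nQ-*-sq m n = trans (nQ-* m (n * n)) (cong (nQ m ℚ.*_) (nQ-* n n))

nQ-*-square : ∀ m n → nQ (m * n ^ 2) ≡ nQ m ℚ.* (nQ n ℚ.* nQ n)
nQ-*-square m n = trans (cong (λ x → nQ (m * (n * x))) (ℕP.*-identityʳ n)) (nQ-*-sq m n)

inv-inverseˡ : ∀ n .{{_ : NonZero n}} → inv n ℚ.* nQ n ≡ 1ℚ
inv-inverseˡ (suc n) = ℚP.toℚᵘ-injective (begin-equality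
  ℚ.toℚᵘ (inv (suc n) ℚ.* nQ (suc n))            ≃⟨ ℚP.toℚᵘ-homo-* (inv (suc n)) (nQ (suc n)) ⟩
  ℚ.toℚᵘ (inv (suc n)) U.* ℚ.toℚᵘ (nQ (suc n))   ≃⟨ UP.*-cong (toℚᵘ-/ (+ 1) n) (toℚᵘ-/ (+ suc n) 0) ⟩
  mkℚᵘ (+ 1) n U.* mkℚᵘ (+ suc n) 0              ≃⟨ *≡* (cong (+_) (ℕP.*-assoc 1 (suc n) 1)) ⟩
  ℚ.toℚᵘ 1ℚ                                      ∎)
  where open UP.≤-Reasoning

inv-inverseʳ : ∀ n .{{_ : NonZero n}} → nQ n ℚ.* inv n ≡ 1ℚ
inv-inverseʳ n = trans (ℚP.*-comm (nQ n) (inv n)) (inv-inverseˡ n)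

nQ-*-cancelˡ : ∀ n .{{_ : NonZero n}} {x y} → nQ n ℚ.* x ≡ nQ n ℚ.* y → x ≡ y
nQ-*-cancelˡ n {x} {y} nx≡ny = begin
  x                          ≡⟨ cancel x ⟨
  inv n ℚ.* (nQ n ℚ.* x)     ≡⟨ cong (inv n ℚ.*_) nx≡ny ⟩
  inv n ℚ.* (nQ n ℚ.* y)     ≡⟨ cancel y ⟩
  y                          ∎
  where
  open ≡-Reasoning
  cancel : ∀ z → inv n ℚ.* (nQ n ℚ.* z) ≡ z
  cancel z = trans (sym (ℚP.*-assoc (inv n) (nQ n) z))
                   (trans (cong (ℚ._* z) (inv-inverseˡ n)) (ℚP.*-identityˡ z))

nQ*inv[*] : ∀ m n .{{_ : NonZero n}} .{{_ : NonZero (m * n)}} → nQ m ℚ.* inv (m * n) ≡ inv n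
nQ*inv[*] m n = nQ-*-cancelˡ n (begin
  nQ n ℚ.* (nQ m ℚ.* inv (m * n))
    ≡⟨ solve 3 (λ N M I → N :* (M :* I) := (M :* N) :* I) refl (nQ n) (nQ m) (inv (m * n)) ⟩
  (nQ m ℚ.* nQ n) ℚ.* inv (m * n)     ≡⟨ cong (ℚ._* inv (m * n)) (nQ-* m n) ⟨
  nQ (m * n) ℚ.* inv (m * n)          ≡⟨ inv-inverseʳ (m * n) ⟩
  1ℚ                                  ≡⟨ inv-inverseʳ n ⟨
  nQ n ℚ.* inv n                      ∎)
  where open ≡-Reasoning

inv-square-scale : ∀ e₂ g .{{_ : NonZero g}} → (inv g ℚ.* inv g) ℚ.* nQ (e₂ * (g * g)) ≡ nQ e₂
inv-square-scale e₂ g = begin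
  (I ℚ.* I) ℚ.* nQ (e₂ * (g * g))     ≡⟨ cong ((I ℚ.* I) ℚ.*_) (nQ-*-sq e₂ g) ⟩
  (I ℚ.* I) ℚ.* (nQ e₂ ℚ.* (G ℚ.* G)) ≡⟨ regroup ⟩
  (I ℚ.* G) ℚ.* (I ℚ.* G) ℚ.* nQ e₂   ≡⟨ cong (λ u → u ℚ.* u ℚ.* nQ e₂) (inv-inverseˡ g) ⟩
  1ℚ ℚ.* 1ℚ ℚ.* nQ e₂                 ≡⟨ solve 1 (λ E → con 1ℚ :* con 1ℚ :* E := E) refl (nQ e₂) ⟩
  nQ e₂                               ∎
  where
  open ≡-Reasoning
  I G : ℚ
  I = inv g
  G = nQ g
  regroup : (I ℚ.* I) ℚ.* (nQ e₂ ℚ.* (G ℚ.* G)) ≡ (I ℚ.* G) ℚ.* (I ℚ.* G) ℚ.* nQ e₂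
  regroup = solve 3 (λ I G E → (I :* I) :* (E :* (G :* G)) := (I :* G) :* (I :* G) :* E) refl I G (nQ e₂)

∣-fromℤ : ∀ {m n} i → + m ℤ.* i ≡ + n → m ∣ n
∣-fromℤ {m} {n} i eq = divides ℤ.∣ i ∣ (begin
  n                  ≡⟨ cong ℤ.∣_∣ eq ⟨
  ℤ.∣ + m ℤ.* i ∣    ≡⟨ ℤP.abs-* (+ m) i ⟩
  m * ℤ.∣ i ∣        ≡⟨ ℕP.*-comm m ℤ.∣ i ∣ ⟩
  ℤ.∣ i ∣ * m        ∎)
  where open ≡-Reasoning

denominator-/ : ∀ i n .{{_ : NonZero n}} → ℚ.denominatorℕ (i / n) ∣ n
denominator-/ i n = ∣-fromℤ _ (ℚP.↧-/ i n)

InZloc-/ : ∀ {M n} i .{{_ : NonZero n}} → Coprime n M → InZloc M (i / n)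
InZloc-/ i cop = divisor-coprime (denominator-/ i _) cop

InZloc-zQ : ∀ {M} i → InZloc M (zQ i)
InZloc-zQ i = InZloc-/ i (C.1-coprimeTo _)

-- On normal forms, p * q and p + q unfold to a fraction over ↧ p * ↧ q.
InZloc-* : ∀ {M} p q → InZloc M p → InZloc M q → InZloc M (p ℚ.* q)
InZloc-* p@record{} q@record{} c₁ c₂ = InZloc-/ (ℚ.↥ p ℤ.* ℚ.↥ q) (coprime-* c₁ c₂)

InZloc-+ : ∀ {M} p q → InZloc M p → InZloc M q → InZloc M (p ℚ.+ q)
InZloc-+ p@record{} q@record{} c₁ c₂ = InZloc-/ (ℚ.↥ p ℤ.* ℚ.↧ q ℤ.+ ℚ.↥ q ℤ.* ℚ.↧ p) (coprime-* c₁ c₂)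

InZloc-neg : ∀ {M} p → InZloc M p → InZloc M (ℚ.- p)
InZloc-neg {M} p = subst (λ d → Coprime d M) (sym (cong ℤ.∣_∣ (ℚP.↧-neg p)))

InZloc-- : ∀ {M} p q → InZloc M p → InZloc M q → InZloc M (p ℚ.- q)
InZloc-- p q c₁ c₂ = InZloc-+ p (ℚ.- q) c₁ (InZloc-neg q c₂)

inverse⇒∣denominator : ∀ d y → nQ d ℚ.* y ≡ 1ℚ → d ∣ ℚ.denominatorℕ y
inverse⇒∣denominator d y@record{} dy≡1 = extract (begin-equality
  mkℚᵘ (+ d) 0 U.* ℚ.toℚᵘ y     ≃⟨ UP.*-cong (toℚᵘ-/ (+ d) 0) UP.≃-refl ⟨
  ℚ.toℚᵘ (nQ d) U.* ℚ.toℚᵘ y    ≃⟨ ℚP.toℚᵘ-homo-* (nQ d) y ⟨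
  ℚ.toℚᵘ (nQ d ℚ.* y)           ≃⟨ ℚP.toℚᵘ-cong dy≡1 ⟩
  ℚ.toℚᵘ 1ℚ                     ∎)
  where
  open UP.≤-Reasoning
  extract : mkℚᵘ (+ d) 0 U.* ℚ.toℚᵘ y U.≃ ℚ.toℚᵘ 1ℚ → d ∣ ℚ.denominatorℕ y
  extract (*≡* eq) = ∣-fromℤ (ℚ.↥ y)
    (trans (sym (ℤP.*-identityʳ _)) (trans eq (trans (ℤP.*-identityˡ _) (ℤP.*-identityˡ _))))

unit⇒coprime : ∀ {M d y} → InZloc M y → nQ d ℚ.* y ≡ 1ℚ → Coprime d M
unit⇒coprime {d = d} {y} y∈ dy≡1 = divisor-coprime (inverse⇒∣denominator d y dy≡1) y∈

bezout⇒coprime : ∀ {M a b x y} → InZloc M x → InZloc M y →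
                 nQ a ℚ.* x ℚ.- nQ b ℚ.* y ≡ 1ℚ → a ∣ M → Coprime a b
bezout⇒coprime {M} {x = x} {y} x∈ y∈ bezout a∣M {d} (divides-refl a₁ , divides-refl b₁) =
  unit⇒coprime {y = z} z∈ dz≡1 (D.∣-refl , D.∣-trans (D.n∣m*n a₁) a∣M)
  where
  open ≡-Reasoning
  z : ℚ
  z = nQ a₁ ℚ.* x ℚ.- nQ b₁ ℚ.* y
  z∈ : InZloc M z
  z∈ = InZloc-- (nQ a₁ ℚ.* x) (nQ b₁ ℚ.* y) (InZloc-* (nQ a₁) x (InZloc-zQ (+ a₁)) x∈)
                                            (InZloc-* (nQ b₁) y (InZloc-zQ (+ b₁)) y∈)
  dz≡1 : nQ d ℚ.* z ≡ 1ℚ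
  dz≡1 = begin
    nQ d ℚ.* z
      ≡⟨ solve 5 (λ D A B x y → D :* (A :* x :- B :* y) := (A :* D) :* x :- (B :* D) :* y)
                 refl (nQ d) (nQ a₁) (nQ b₁) x y ⟩
    (nQ a₁ ℚ.* nQ d) ℚ.* x ℚ.- (nQ b₁ ℚ.* nQ d) ℚ.* y
      ≡⟨ cong₂ (λ u v → u ℚ.* x ℚ.- v ℚ.* y) (nQ-* a₁ d) (nQ-* b₁ d) ⟨
    nQ (a₁ * d) ℚ.* x ℚ.- nQ (b₁ * d) ℚ.* y
      ≡⟨ bezout ⟩
    1ℚ                                                ∎

mat-cong : ∀ {a b c d a′ b′ c′ d′} → a ≡ a′ → b ≡ b′ → c ≡ c′ → d ≡ d′ → mat a b c d ≡ mat a′ b′ c′ d′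
mat-cong refl refl refl refl = refl

smul-smul : ∀ s t A → smul s (smul t A) ≡ smul (s ℚ.* t) A
smul-smul s t (mat a b c d) = mat-cong (assoc a) (assoc b) (assoc c) (assoc d)
  where
  assoc : ∀ x → s ℚ.* (t ℚ.* x) ≡ (s ℚ.* t) ℚ.* x
  assoc x = sym (ℚP.*-assoc s t x)

smul-identity : ∀ A → smul 1ℚ A ≡ A
smul-identity (mat a b c d) = mat-cong (ℚP.*-identityˡ a) (ℚP.*-identityˡ b) (ℚP.*-identityˡ c) (ℚP.*-identityˡ d)

det-smul : ∀ t A → det (smul t A) ≡ (t ℚ.* t) ℚ.* det A
det-smul t (mat a b c d) =
  solve 5 (λ t a b c d → (t :* a) :* (t :* d) :- (t :* b) :* (t :* c) := (t :* t) :* (a :* d :- b :* c)) refl t a b c d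

det-bezout : ∀ f e h .{{_ : NonZero e}} .{{_ : NonZero h}} p q r s →
  det (mat (nQ e ℚ.* p) (q ℚ.* inv h) ((nQ ((f * e) * h ^ 2) ℚ.* r) ℚ.* inv h) (nQ e ℚ.* s)) ≡ nQ e →
  nQ e ℚ.* (p ℚ.* s) ℚ.- nQ f ℚ.* (q ℚ.* r) ≡ 1ℚ
det-bezout f e h p q r s detA = nQ-*-cancelˡ e (begin
  E ℚ.* Z                                                  ≡⟨ expand ⟩
  E ℚ.* (E ℚ.* (p ℚ.* s)) ℚ.- (F ℚ.* E) ℚ.* (q ℚ.* r) ℚ.* (1ℚ ℚ.* 1ℚ)
    ≡⟨ cong (λ u → E ℚ.* (E ℚ.* (p ℚ.* s)) ℚ.- (F ℚ.* E) ℚ.* (q ℚ.* r) ℚ.* (u ℚ.* u)) (inv-inverseˡ h) ⟨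
  E ℚ.* (E ℚ.* (p ℚ.* s)) ℚ.- (F ℚ.* E) ℚ.* (q ℚ.* r) ℚ.* ((I ℚ.* H) ℚ.* (I ℚ.* H))
    ≡⟨ regroup ⟩
  (E ℚ.* p) ℚ.* (E ℚ.* s) ℚ.- (q ℚ.* I) ℚ.* (((F ℚ.* E) ℚ.* (H ℚ.* H)) ℚ.* r ℚ.* I)
    ≡⟨ cong (λ m → (E ℚ.* p) ℚ.* (E ℚ.* s) ℚ.- (q ℚ.* I) ℚ.* ((m ℚ.* r) ℚ.* I)) nQM ⟨
  det (mat (E ℚ.* p) (q ℚ.* I) ((nQ ((f * e) * h ^ 2) ℚ.* r) ℚ.* I) (E ℚ.* s))
    ≡⟨ detA ⟩
  E                                                        ≡⟨ ℚP.*-identityʳ E ⟨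
  E ℚ.* 1ℚ                                                 ∎)
  where
  open ≡-Reasoning
  E F H I Z : ℚ
  E = nQ e
  F = nQ f
  H = nQ h
  I = inv h
  Z = E ℚ.* (p ℚ.* s) ℚ.- F ℚ.* (q ℚ.* r)
  nQM : nQ ((f * e) * h ^ 2) ≡ (F ℚ.* E) ℚ.* (H ℚ.* H)
  nQM = trans (nQ-*-square (f * e) h) (cong (ℚ._* (H ℚ.* H)) (nQ-* f e))
  expand : E ℚ.* Z ≡ E ℚ.* (E ℚ.* (p ℚ.* s)) ℚ.- (F ℚ.* E) ℚ.* (q ℚ.* r) ℚ.* (1ℚ ℚ.* 1ℚ)
  expand = solve 6 (λ E F p q r s → E :* (E :* (p :* s) :- F :* (q :* r))
                                    := E :* (E :* (p :* s)) :- (F :* E) :* (q :* r) :* (con 1ℚ :* con 1ℚ))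
                   refl E F p q r s
  regroup : E ℚ.* (E ℚ.* (p ℚ.* s)) ℚ.- (F ℚ.* E) ℚ.* (q ℚ.* r) ℚ.* ((I ℚ.* H) ℚ.* (I ℚ.* H))
          ≡ (E ℚ.* p) ℚ.* (E ℚ.* s) ℚ.- (q ℚ.* I) ℚ.* (((F ℚ.* E) ℚ.* (H ℚ.* H)) ℚ.* r ℚ.* I)
  regroup = solve 8 (λ E F H I p q r s → E :* (E :* (p :* s)) :- (F :* E) :* (q :* r) :* ((I :* H) :* (I :* H))
                                         := (E :* p) :* (E :* s) :- (q :* I) :* (((F :* E) :* (H :* H)) :* r :* I))
                    refl E F H I p q r s

rescale : ∀ e₂ g k₁ h m .{{_ : NonZero g}} .{{_ : NonZero h}} .{{_ : NonZero ((k₁ * g) * h)}} p q r s →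
  mat (nQ e₂ ℚ.* (nQ g ℚ.* p)) ((nQ k₁ ℚ.* q) ℚ.* inv ((k₁ * g) * h))
      ((nQ m ℚ.* (nQ k₁ ℚ.* r)) ℚ.* inv ((k₁ * g) * h)) (nQ e₂ ℚ.* (nQ g ℚ.* s))
  ≡ smul (inv g) (mat (nQ (e₂ * (g * g)) ℚ.* p) (q ℚ.* inv h)
                      ((nQ m ℚ.* r) ℚ.* inv h) (nQ (e₂ * (g * g)) ℚ.* s))
rescale e₂ g k₁ h m p q r s = begin
  B′                               ≡⟨ smul-identity B′ ⟨
  smul 1ℚ B′                       ≡⟨ cong (λ t → smul t B′) (inv-inverseˡ g) ⟨
  smul (inv g ℚ.* G) B′            ≡⟨ smul-smul (inv g) G B′ ⟨
  smul (inv g) (smul G B′)         ≡⟨ cong (smul (inv g)) (mat-cong (unscale-e p) (unscale-h q) unscale-c (unscale-e s)) ⟩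
  smul (inv g) _                   ∎
  where
  open ≡-Reasoning
  G K I′ : ℚ
  G = nQ g
  K = nQ k₁
  I′ = inv ((k₁ * g) * h)
  B′ : M2
  B′ = mat (nQ e₂ ℚ.* (G ℚ.* p)) ((K ℚ.* q) ℚ.* I′) ((nQ m ℚ.* (K ℚ.* r)) ℚ.* I′) (nQ e₂ ℚ.* (G ℚ.* s))
  unscale-e : ∀ x → G ℚ.* (nQ e₂ ℚ.* (G ℚ.* x)) ≡ nQ (e₂ * (g * g)) ℚ.* x
  unscale-e x = begin
    G ℚ.* (nQ e₂ ℚ.* (G ℚ.* x))
      ≡⟨ solve 3 (λ G E x → G :* (E :* (G :* x)) := (E :* (G :* G)) :* x) refl G (nQ e₂) x ⟩
    (nQ e₂ ℚ.* (G ℚ.* G)) ℚ.* x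
      ≡⟨ cong (ℚ._* x) (nQ-*-sq e₂ g) ⟨
    nQ (e₂ * (g * g)) ℚ.* x         ∎
  unscale-h : ∀ x → G ℚ.* ((K ℚ.* x) ℚ.* I′) ≡ x ℚ.* inv h
  unscale-h x = begin
    G ℚ.* ((K ℚ.* x) ℚ.* I′)
      ≡⟨ solve 4 (λ G K x I → G :* ((K :* x) :* I) := x :* ((K :* G) :* I)) refl G K x I′ ⟩
    x ℚ.* ((K ℚ.* G) ℚ.* I′)
      ≡⟨ cong (λ y → x ℚ.* (y ℚ.* I′)) (nQ-* k₁ g) ⟨
    x ℚ.* (nQ (k₁ * g) ℚ.* I′)
      ≡⟨ cong (x ℚ.*_) (nQ*inv[*] (k₁ * g) h) ⟩
    x ℚ.* inv h                     ∎
  unscale-c : G ℚ.* ((nQ m ℚ.* (K ℚ.* r)) ℚ.* I′) ≡ (nQ m ℚ.* r) ℚ.* inv h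
  unscale-c = trans (cong (λ y → G ℚ.* (y ℚ.* I′)) (solve 3 (λ m K r → m :* (K :* r) := K :* (m :* r)) refl (nQ m) K r))
                    (unscale-h (nQ m ℚ.* r))

Member-rescale : ∀ {M} (P : ℚ → Set) → (∀ n {x} → P x → P (nQ n ℚ.* x)) →
  ∀ h k {N′} .{{_ : NonZero h}} .{{_ : NonZero (k * h)}} (eq′ : M ≡ N′ * (k * h) ^ 2) e .{{_ : NonZero e}} p q r s →
  P p → P q → P r → P s →
  det (mat (nQ e ℚ.* p) (q ℚ.* inv h) ((nQ M ℚ.* r) ℚ.* inv h) (nQ e ℚ.* s)) ≡ nQ e →
  (Σ ℕ λ g → NonZero g × Σ ℕ λ e₂ → Σ ℕ λ k₁ → e ≡ e₂ * (g * g) × k ≡ k₁ * g × e₂ ∣ N′) →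
  Σ Rep λ γ′ → Member P M (k * h) (divides N′ eq′) γ′
               × SameReal (rep e (mat (nQ e ℚ.* p) (q ℚ.* inv h) ((nQ M ℚ.* r) ℚ.* inv h) (nQ e ℚ.* s))) γ′
Member-rescale {M} P scale h k eq′ e p q r s Pp Pq Pr Ps detA (g , g≢0 , e₂ , k₁ , refl , refl , e₂∣N′) =
  rep e₂ B′ ,
  (e₂≢0 , e₂∣N′ , nQ g ℚ.* p , nQ k₁ ℚ.* q , nQ k₁ ℚ.* r , nQ g ℚ.* s ,
   scale g Pp , scale k₁ Pq , scale k₁ Pr , scale g Ps , refl , detB′) ,
  (inv g , ℚP.normalize-pos 1 g , inv-square-scale e₂ g , B′≡tB)
  where
  instance _ = g≢0
  e₂≢0 : NonZero e₂
  e₂≢0 = ℕP.m*n≢0⇒m≢0 e₂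
  B : M2
  B = mat (nQ (e₂ * (g * g)) ℚ.* p) (q ℚ.* inv h) ((nQ M ℚ.* r) ℚ.* inv h) (nQ (e₂ * (g * g)) ℚ.* s)
  B′ : M2
  B′ = mat (nQ e₂ ℚ.* (nQ g ℚ.* p)) ((nQ k₁ ℚ.* q) ℚ.* inv ((k₁ * g) * h))
           ((nQ M ℚ.* (nQ k₁ ℚ.* r)) ℚ.* inv ((k₁ * g) * h)) (nQ e₂ ℚ.* (nQ g ℚ.* s))
  B′≡tB : B′ ≡ smul (inv g) B
  B′≡tB = rescale e₂ g k₁ h M p q r s
  detB′ : det B′ ≡ nQ e₂
  detB′ = begin
    det B′                                     ≡⟨ cong det B′≡tB ⟩
    det (smul (inv g) B)                       ≡⟨ det-smul (inv g) B ⟩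
    (inv g ℚ.* inv g) ℚ.* det B                ≡⟨ cong ((inv g ℚ.* inv g) ℚ.*_) detA ⟩
    (inv g ℚ.* inv g) ℚ.* nQ (e₂ * (g * g))    ≡⟨ inv-square-scale e₂ g ⟩
    nQ e₂                                      ∎
    where open ≡-Reasoning

Member-mono : ∀ {M} (P : ℚ → Set) → (∀ {x} → P x → InZloc M x) → (∀ n {x} → P x → P (nQ n ℚ.* x)) →
  (h h′ : ℕ) → .{{_ : NonZero h}} → .{{_ : NonZero h′}} → (hh : h ^ 2 ∣ M) (hh′ : h′ ^ 2 ∣ M) → h ∣ h′ →
  (γ : Rep) → Member P M h hh γ → Σ Rep λ γ′ → Member P M h′ hh′ γ′ × SameReal γ γ′
Member-mono P P⊆Zloc scale h h′ (divides-refl N) (divides N′ eq′) (divides-refl k) (rep e _)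
  (e≢0 , divides-refl f , p , q , r , s , Pp , Pq , Pr , Ps , refl , detA) =
  Member-rescale P scale h k eq′ e {{e≢0}} p q r s Pp Pq Pr Ps detA
    (square-part {{e≢0}} {{ℕP.m*n≢0⇒m≢0 k}} coprime (cancel-square (f * e) N′ k h eq′))
  where
  coprime : Coprime e f
  coprime = bezout⇒coprime (InZloc-* p s (P⊆Zloc Pp) (P⊆Zloc Ps)) (InZloc-* q r (P⊆Zloc Pq) (P⊆Zloc Pr))
              (det-bezout f e h {{e≢0}} p q r s detA) (D.∣-trans (D.n∣m*n f) (D.m∣m*n (h ^ 2)))

IsInt-scale : ∀ n {x} → IsInt x → IsInt (nQ n ℚ.* x)
IsInt-scale n (z , refl) = + n ℤ.* z , sym (zQ-* (+ n) z)

IsInt⇒InZloc : ∀ {M x} → IsInt x → InZloc M x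
IsInt⇒InZloc (z , refl) = InZloc-zQ z

InZloc-scale : ∀ M n {x} → InZloc M x → InZloc M (nQ n ℚ.* x)
InZloc-scale M n {x} = InZloc-* (nQ n) x (InZloc-zQ (+ n))

lemma5p4 : (M : ℕ) → .{{NonZero M}} → (h h' : ℕ) → .{{_ : NonZero h}} → .{{_ : NonZero h'}} →
    (hh : h ^ 2 ∣ M) → (hh' : h' ^ 2 ∣ M) → h ∣ h' →
    ((g : Rep) → InΓ0 M h hh g → Σ Rep λ g' → InΓ0 M h' hh' g' × SameReal g g')
    × ((g : Rep) → InG0 M h hh g → Σ Rep λ g' → InG0 M h' hh' g' × SameReal g g')
lemma5p4 M h h' hh hh' h∣h' =
  Member-mono IsInt IsInt⇒InZloc IsInt-scale h h' hh hh' h∣h' ,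
  Member-mono (InZloc M) id (InZloc-scale M) h h' hh hh' h∣h'
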